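{- Let $k\geq 2$ and $n\geq 1$. For every polynomial $Q\in \mathbb{R}[x_1,\dots,x_n]$ there is at most one polynomial $P\in U_k$ such that $Q-P$ has zeroes of multiplicity at least $k$ at all points in $\{0,1\}^n\setminus \{(0,\dots,0)\}$ and a zero of multiplicity at least $k-1$ at $(0,\dots,0)$.
   Context: A polynomial has a zero of multiplicity at least $k$ at $a\in\mathbb{R}^n$ if all its partial derivatives of order at most $k-1$ vanish at $a$. A polynomial $P\in \mathbb{R}[x_1,\dots,x_n]$ is called $k$-reduced if $\deg P\leq n+2k-3$ and no monomial occurring in $P$ is divisible by $x_{i_1}^2\dotsm x_{i_k}^2$ for any (not necessarily distinct) indices $i_1,\dots,i_k\in \{1,\dots,n\}$. $U_k\subseteq \mathbb{R}[x_1,\dots,x_n]$ denotes the vector space of all $k$-reduced polynomials. -}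

module Defs where

open import Level using (0ℓ)
open import Algebra.Bundles using (CommutativeRing)
open import Relation.Binary.Structures using (IsStrictTotalOrder)
open import Data.Nat as ℕ using (ℕ; zero; suc)
open import Data.Fin using (Fin)
open import Data.Vec as Vec using (Vec; lookup; updateAt; replicate)
open import Data.Vec.Properties using (≡-dec)
open import Data.List as List using (List; []; _∷_; _++_; length)
open import Data.Bool using (Bool; true; false)
open import Data.Product using (Σ; ∃; _×_; _,_)
open import Data.Sum using (_⊎_)
open import Relation.Nullary using (¬_; yes; no)
open import Relation.Binary.PropositionalEquality using (_≡_)

-- The real numbers, axiomatised as a complete ordered field
-- (unique up to isomorphism, so quantifying over all such models = ℝ).

record RealField : Set₁ where
  field
    commRing : CommutativeRing 0ℓ 0ℓ
  open CommutativeRing commRing public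
  field
    _<_                : Carrier → Carrier → Set
    isStrictTotalOrder : IsStrictTotalOrder _≈_ _<_
    +-mono-<           : ∀ {x y} z → x < y → (x + z) < (y + z)
    *-pos              : ∀ {x y} → 0# < x → 0# < y → 0# < (x * y)
    0≉1                : ¬ (0# ≈ 1#)
    inverse            : ∀ x → ¬ (x ≈ 0#) → Σ Carrier λ y → (x * y) ≈ 1#
  _≤_ : Carrier → Carrier → Set
  x ≤ y = (x < y) ⊎ (x ≈ y)
  field
    sup : (S : Carrier → Set) → ∃ S → (∃ λ b → ∀ x → S x → x ≤ b) →
          ∃ λ s → (∀ x → S x → x ≤ s) × (∀ b → (∀ x → S x → x ≤ b) → s ≤ b)

-- Polynomials in n variables over R, given as finite formal sums of
-- terms c · x^e (c : coefficient, e : exponent vector).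

Monomial : ℕ → Set
Monomial n = Vec ℕ n

mdeg : ∀ {n} → Monomial n → ℕ
mdeg = Vec.sum

squares : ∀ {n k} → Vec (Fin n) k → Monomial n
squares {n} is = Vec.foldr _ (λ i e → updateAt e i (λ m → suc (suc m))) (replicate n 0) is

_∣ₘ_ : ∀ {n} → Monomial n → Monomial n → Set
_∣ₘ_ {n} f e = ∀ (j : Fin n) → lookup f j ℕ.≤ lookup e j

DivBySquares : ∀ {n} → ℕ → Monomial n → Set
DivBySquares {n} k e = ∃ λ (is : Vec (Fin n) k) → squares is ∣ₘ e

ff : ℕ → ℕ → ℕ
ff e zero = 1
ff zero (suc a) = 0
ff (suc e) (suc a) = suc e ℕ.* ff e a

module _ (R : RealField) where
  open RealField R

  Poly : ℕ → Set
  Poly n = List (Carrier × Monomial n)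

  ι : ℕ → Carrier
  ι zero = 0#
  ι (suc m) = 1# + ι m

  coef : ∀ {n} → Poly n → Monomial n → Carrier
  coef [] m = 0#
  coef ((c , e) ∷ P) m with ≡-dec ℕ._≟_ e m
  ... | yes _ = c + coef P m
  ... | no  _ = coef P m

  _≈ₚ_ : ∀ {n} → Poly n → Poly n → Set
  P ≈ₚ P' = ∀ m → coef P m ≈ coef P' m

  _-ₚ_ : ∀ {n} → Poly n → Poly n → Poly n
  Q -ₚ P = Q ++ List.map (λ { (c , e) → (- c , e) }) P

  ∂ : ∀ {n} → Fin n → Poly n → Poly n
  ∂ i = List.map (λ { (c , e) → (c * ι (lookup e i) , updateAt e i ℕ.pred) })

  ∂* : ∀ {n} → List (Fin n) → Poly n → Poly n
  ∂* [] P = P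
  ∂* (i ∷ is) P = ∂ i (∂* is P)

  pow : Carrier → ℕ → Carrier
  pow a zero = 1#
  pow a (suc m) = a * pow a m

  evalMon : ∀ {n} → Monomial n → Vec Carrier n → Carrier
  evalMon Vec.[] Vec.[] = 1#
  evalMon (e Vec.∷ es) (a Vec.∷ as) = pow a e * evalMon es as

  eval : ∀ {n} → Poly n → Vec Carrier n → Carrier
  eval [] a = 0#
  eval ((c , e) ∷ P) a = (c * evalMon e a) + eval P a

  ZeroOfMult : ∀ {n} → Poly n → Vec Carrier n → ℕ → Set
  ZeroOfMult P a m = ∀ is → length is ℕ.< m → eval (∂* is P) a ≈ 0#

  Reduced : ∀ {n} → ℕ → Poly n → Set
  Reduced {n} k P = ∀ e → ¬ (coef P e ≈ 0#) →
    (mdeg e ℕ.≤ (n ℕ.+ 2 ℕ.* k) ℕ.∸ 3) × ¬ DivBySquares k e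

  pt : ∀ {n} → Vec Bool n → Vec Carrier n
  pt = Vec.map (λ { true → 1# ; false → 0# })

  Interpolates : ∀ {n} → ℕ → Poly n → Poly n → Set
  Interpolates {n} k Q P =
    (∀ (b : Vec Bool n) → ¬ (b ≡ replicate n false) → ZeroOfMult (Q -ₚ P) (pt b) k)
    × ZeroOfMult (Q -ₚ P) (pt (replicate n false)) (k ℕ.∸ 1)

module Submission where

-- Put D = P₁ − P₂. It is k-reduced, vanishes to order k on {0,1}ⁿ ∖ {0} and to order
-- k − 1 at 0; we show by induction on n and k that such a polynomial is 0. Write
-- D = A(x) + t·B(x) + (t² − t)·C(t, x) in the first variable t. The slices t = 0 and t = 1
-- show that B satisfies the same hypotheses in n − 1 variables, hence B = 0; then A vanishes
-- to order k on the whole cube and has no monomial divisible by k squares, which by the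
-- analogous induction forces A = 0. So D = (t² − t)·C, and at t ∈ {0, 1}, where t² − t = 0
-- but 2t − 1 ≠ 0, the Leibniz rule lowers the vanishing order of C by one. Multiplying by
-- t² adds a square and two to the degree, so C is (k − 1)-reduced and C = 0. Polynomials
-- are handled through the values of all their derivatives, and these at the origin recover
-- the coefficients.

open import Defs
open import Data.Nat using (ℕ; _≤_)
open import Data.Nat as ℕ using (zero; suc; pred; z≤n; s≤s)
import Data.Nat.Properties as ℕₚ
open import Data.Nat.Tactic.RingSolver using (solve-∀)
open import Data.Fin using (Fin; zero; suc)
open import Data.Vec as Vec using (Vec; []; _∷_; lookup; updateAt; replicate)
open import Data.Vec.Properties using (≡-dec; ∷-injectiveʳ; lookup-replicate)
open import Data.List as List using (List; []; _∷_; _++_; length; filter)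
import Data.List.Properties as Listₚ
open import Data.List.Relation.Unary.All as All using (All; []; _∷_)
import Data.List.Relation.Unary.All.Properties as Allₚ
open import Data.Bool using (Bool; true; false)
open import Data.Product using (_×_; _,_; proj₁; proj₂)
open import Data.Empty using (⊥-elim)
open import Function using (_∘_)
open import Relation.Nullary using (¬_; yes; no; Dec; ¬?)
open import Relation.Binary.PropositionalEquality as ≡ using (_≡_; _≢_)
open import Relation.Binary.Definitions using (tri<; tri≈; tri>)
open import Relation.Binary.Structures using (IsStrictTotalOrder)
import Algebra.Properties.Ring as RingProperties
import Algebra.Properties.CommutativeSemigroup as CommutativeSemigroupProperties
import Algebra.Solver.Ring.NaturalCoefficients.Default as NaturalCoefficientSolver

ff-pascal : ∀ j a → suc j ℕ.* ff j a ≡ ff j (suc a) ℕ.+ suc a ℕ.* ff j a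
ff-pascal zero    zero    = ≡.refl
ff-pascal zero    (suc a) = ≡.sym (ℕₚ.*-zeroʳ (suc (suc a)))
ff-pascal (suc j) zero    = ℕₚ.+-comm 1 (suc j ℕ.* 1)
ff-pascal (suc j) (suc a) = begin
  suc (suc j) ℕ.* (suc j ℕ.* x)                  ≡⟨ expand (suc j) x ⟩
  suc j ℕ.* (suc j ℕ.* x) ℕ.+ suc j ℕ.* x        ≡⟨ ≡.cong (λ z → suc j ℕ.* z ℕ.+ suc j ℕ.* x) (ff-pascal j a) ⟩
  suc j ℕ.* (y ℕ.+ suc a ℕ.* x) ℕ.+ suc j ℕ.* x  ≡⟨ regroup (suc j) a x y ⟩
  suc j ℕ.* y ℕ.+ suc (suc a) ℕ.* (suc j ℕ.* x)  ∎
  where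
  open ≡.≡-Reasoning
  x = ff j a
  y = ff j (suc a)
  expand : ∀ m x → suc m ℕ.* (m ℕ.* x) ≡ m ℕ.* (m ℕ.* x) ℕ.+ m ℕ.* x
  expand = solve-∀
  regroup : ∀ m a x y → m ℕ.* (y ℕ.+ suc a ℕ.* x) ℕ.+ m ℕ.* x ≡ m ℕ.* y ℕ.+ suc (suc a) ℕ.* (m ℕ.* x)
  regroup = solve-∀

ff-< : ∀ {j a} → j ℕ.< a → ff j a ≡ 0
ff-< {zero}  {suc a} _         = ≡.refl
ff-< {suc j} {suc a} (s≤s j<a) = ≡.trans (≡.cong (suc j ℕ.*_) (ff-< j<a)) (ℕₚ.*-zeroʳ (suc j))

ff-diag>0 : ∀ a → 0 ℕ.< ff a a
ff-diag>0 zero    = s≤s z≤n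
ff-diag>0 (suc a) = ℕₚ.*-mono-< {0} {suc a} {0} (s≤s z≤n) (ff-diag>0 a)

∸-suc : ∀ {j a} → a ℕ.< j → j ℕ.∸ a ≡ suc (j ℕ.∸ suc a)
∸-suc {suc j} {zero}  _         = ≡.refl
∸-suc {suc j} {suc a} (s≤s a<j) = ∸-suc a<j

-- deg e ≤ n + 2k − 3, stated without truncated subtraction
DegreeBound : ∀ {n} → ℕ → Monomial n → Set
DegreeBound {n} k e = mdeg e ℕ.+ 3 ≤ n ℕ.+ 2 ℕ.* k

degreeBound-tail : ∀ {j n k} (e : Monomial n) → DegreeBound k (suc j ∷ e) → DegreeBound k e
degreeBound-tail {j} e h = ℕₚ.≤-trans (ℕₚ.+-monoˡ-≤ 3 (ℕₚ.m≤n+m (mdeg e) j)) (ℕₚ.≤-pred h)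

degreeBound-quot : ∀ {i j n k} (e : Monomial n) → suc (suc i) ≤ j →
  DegreeBound (suc k) (j ∷ e) → DegreeBound k (i ∷ e)
degreeBound-quot {i} {j} {n} {k} e i+2≤j h = ℕₚ.+-cancelʳ-≤ 2 _ _ (begin
  i ℕ.+ mdeg e ℕ.+ 3 ℕ.+ 2      ≡⟨ shift i (mdeg e) ⟩
  suc (suc i) ℕ.+ mdeg e ℕ.+ 3  ≤⟨ ℕₚ.+-monoˡ-≤ 3 (ℕₚ.+-monoˡ-≤ (mdeg e) i+2≤j) ⟩
  j ℕ.+ mdeg e ℕ.+ 3            ≤⟨ h ⟩
  suc n ℕ.+ 2 ℕ.* suc k         ≡⟨ unfold n k ⟩
  suc n ℕ.+ 2 ℕ.* k ℕ.+ 2       ∎)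
  where
  open ℕₚ.≤-Reasoning
  shift : ∀ i m → i ℕ.+ m ℕ.+ 3 ℕ.+ 2 ≡ suc (suc i) ℕ.+ m ℕ.+ 3
  shift = solve-∀
  unfold : ∀ n k → suc n ℕ.+ 2 ℕ.* suc k ≡ suc n ℕ.+ 2 ℕ.* k ℕ.+ 2
  unfold = solve-∀

squares-map-suc : ∀ {n k} (is : Vec (Fin n) k) → squares (Vec.map suc is) ≡ 0 ∷ squares is
squares-map-suc []       = ≡.refl
squares-map-suc (i ∷ is) = ≡.cong (λ v → updateAt v (suc i) (λ m → ℕ.suc (ℕ.suc m))) (squares-map-suc is)

divBySquares-zero : ∀ {n} (e : Monomial n) → DivBySquares 0 e
divBySquares-zero e = [] , λ j → ≡.subst (_≤ lookup e j) (≡.sym (lookup-replicate j 0)) z≤n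

divBySquares-cons : ∀ {n k} j (e : Monomial n) → DivBySquares k e → DivBySquares k (j ∷ e)
divBySquares-cons j e (is , sq∣e) = Vec.map suc is , divides
  where
  divides : squares (Vec.map suc is) ∣ₘ (j ∷ e)
  divides x rewrite squares-map-suc is with x
  ... | zero  = z≤n
  ... | suc y = sq∣e y

divBySquares-suc : ∀ {n k} i j (e : Monomial n) → suc (suc i) ≤ j →
  DivBySquares k (i ∷ e) → DivBySquares (suc k) (j ∷ e)
divBySquares-suc i j e i+2≤j (is , sq∣ie) = zero ∷ is , divides (squares is) sq∣ie
  where
  divides : ∀ v → v ∣ₘ (i ∷ e) → updateAt v zero (λ m → ℕ.suc (ℕ.suc m)) ∣ₘ (j ∷ e)
  divides (h ∷ t) v∣ie zero    = ℕₚ.≤-trans (s≤s (s≤s (v∣ie zero))) i+2≤j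
  divides (h ∷ t) v∣ie (suc y) = v∣ie (suc y)

NoSquares : ∀ {n} → ℕ → Monomial n → Set
NoSquares k e = ¬ DivBySquares k e

ReducedMonomial : ∀ {n} → ℕ → Monomial n → Set
ReducedMonomial k e = NoSquares k e × DegreeBound k e

noSquares-tail : ∀ {n k j} {e : Monomial n} → NoSquares k (j ∷ e) → NoSquares k e
noSquares-tail {j = j} {e} noSq = noSq ∘ divBySquares-cons j e

noSquares-quot : ∀ {n k i j} {e : Monomial n} → suc (suc i) ≤ j → NoSquares (suc k) (j ∷ e) → NoSquares k (i ∷ e)
noSquares-quot {i = i} {j} {e} i+2≤j noSq = noSq ∘ divBySquares-suc i j e i+2≤j

reducedMonomial-tail : ∀ {n k j} {e : Monomial n} → ReducedMonomial k (suc j ∷ e) → ReducedMonomial k e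
reducedMonomial-tail {k = k} {e = e} (noSq , deg) = noSquares-tail noSq , degreeBound-tail {k = k} e deg

reducedMonomial-quot : ∀ {n k i j} {e : Monomial n} → suc (suc i) ≤ j →
  ReducedMonomial (suc k) (j ∷ e) → ReducedMonomial k (i ∷ e)
reducedMonomial-quot {e = e} i+2≤j (noSq , deg) = noSquares-quot i+2≤j noSq , degreeBound-quot e i+2≤j deg

tally : ∀ {n} → List (Fin n) → Vec ℕ n → Vec ℕ n
tally []       α = α
tally (i ∷ is) α = tally is (updateAt α i suc)

indices : ∀ {n} → Vec ℕ n → List (Fin n)
indices []      = []
indices (a ∷ α) = List.replicate a zero ++ List.map suc (indices α)

tally-++ : ∀ {n} (is js : List (Fin n)) α → tally (is ++ js) α ≡ tally js (tally is α)
tally-++ []       js α = ≡.refl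
tally-++ (i ∷ is) js α = tally-++ is js _

tally-replicate : ∀ {n} a x (β : Vec ℕ n) → tally (List.replicate a zero) (x ∷ β) ≡ (a ℕ.+ x) ∷ β
tally-replicate zero    x β = ≡.refl
tally-replicate (suc a) x β = ≡.trans (tally-replicate a (suc x) β) (≡.cong (_∷ β) (ℕₚ.+-suc a x))

tally-map-suc : ∀ {n} (is : List (Fin n)) x β → tally (List.map suc is) (x ∷ β) ≡ x ∷ tally is β
tally-map-suc []       x β = ≡.refl
tally-map-suc (i ∷ is) x β = tally-map-suc is x _

tally-indices : ∀ {n} (α : Vec ℕ n) → tally (indices α) (replicate n 0) ≡ α
tally-indices []      = ≡.refl
tally-indices (a ∷ α) = begin
  tally (as ++ bs) (0 ∷ 0s)        ≡⟨ tally-++ as bs _ ⟩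
  tally bs (tally as (0 ∷ 0s))     ≡⟨ ≡.cong (tally bs) (tally-replicate a 0 0s) ⟩
  tally bs ((a ℕ.+ 0) ∷ 0s)        ≡⟨ tally-map-suc (indices α) _ 0s ⟩
  (a ℕ.+ 0) ∷ tally (indices α) 0s ≡⟨ ≡.cong₂ _∷_ (ℕₚ.+-identityʳ a) (tally-indices α) ⟩
  a ∷ α                            ∎
  where
  open ≡.≡-Reasoning
  as = List.replicate a zero
  bs = List.map suc (indices α)
  0s = replicate _ 0

length-indices : ∀ {n} (α : Vec ℕ n) → length (indices α) ≡ mdeg α
length-indices []      = ≡.refl
length-indices (a ∷ α) = begin
  length (as ++ bs)            ≡⟨ Listₚ.length-++ as ⟩
  length as ℕ.+ length bs      ≡⟨ ≡.cong₂ ℕ._+_ (Listₚ.length-replicate a) (Listₚ.length-map suc (indices α)) ⟩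
  a ℕ.+ length (indices α)     ≡⟨ ≡.cong (a ℕ.+_) (length-indices α) ⟩
  a ℕ.+ mdeg α                 ∎
  where
  open ≡.≡-Reasoning
  as = List.replicate a zero
  bs = List.map suc (indices α)

module _ (R : RealField) where
  open RealField R hiding (_≤_; zero)
  open RingProperties ring using (-‿distribˡ-*; -‿involutive; -0#≈0#; -‿+-comm; x[y-z]≈xy-xz; [y-z]x≈yx-zx; x∙y⁻¹≈ε⇒x≈y; x≈y⇒x∙y⁻¹≈ε)
  open CommutativeSemigroupProperties *-commutativeSemigroup using (x∙yz≈y∙xz)
  open IsStrictTotalOrder isStrictTotalOrder using (compare; <-resp-≈) renaming (trans to <-trans; irrefl to <-irrefl; _≟_ to _≈?_)
  open NaturalCoefficientSolver commutativeSemiring using (solve; _:=_; _:+_; _:*_; con)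
  open import Relation.Binary.Reasoning.Setoid setoid

  ι-+ : ∀ m n → ι R (m ℕ.+ n) ≈ ι R m + ι R n
  ι-+ zero    n = sym (+-identityˡ _)
  ι-+ (suc m) n = trans (+-congˡ (ι-+ m n)) (sym (+-assoc _ _ _))

  ι-* : ∀ m n → ι R (m ℕ.* n) ≈ ι R m * ι R n
  ι-* zero    n = sym (zeroˡ _)
  ι-* (suc m) n = begin
    ι R (n ℕ.+ m ℕ.* n)         ≈⟨ trans (ι-+ n (m ℕ.* n)) (+-congˡ (ι-* m n)) ⟩
    ι R n + ι R m * ι R n       ≈⟨ solve 2 (λ x y → x :+ y :* x := (con 1 :+ y) :* x) refl (ι R n) (ι R m) ⟩
    (1# + ι R m) * ι R n        ∎

  0<1 : 0# < 1#
  0<1 with compare 0# 1#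
  ... | tri< 0<1 _ _ = 0<1
  ... | tri≈ _ 0≈1 _ = ⊥-elim (0≉1 0≈1)
  ... | tri> _ _ 1<0 = ⊥-elim (<-irrefl refl (<-trans (proj₁ <-resp-≈ 1≈-1*-1 (*-pos 0<-1 0<-1)) 1<0))
    where
    0<-1 : 0# < (- 1#)
    0<-1 = proj₁ <-resp-≈ (+-identityˡ _) (proj₂ <-resp-≈ (-‿inverseʳ 1#) (+-mono-< (- 1#) 1<0))
    1≈-1*-1 : - 1# * - 1# ≈ 1#
    1≈-1*-1 = trans (sym (-‿distribˡ-* 1# (- 1#))) (trans (-‿cong (*-identityˡ _)) (-‿involutive 1#))

  0<ι-suc : ∀ m → 0# < ι R (suc m)
  0<ι-suc zero    = proj₁ <-resp-≈ (sym (+-identityʳ _)) 0<1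
  0<ι-suc (suc m) = <-trans 0<1 (proj₁ <-resp-≈ (+-comm _ _)
                      (proj₂ <-resp-≈ (+-identityˡ _) (+-mono-< 1# (0<ι-suc m))))

  ι-suc≉0 : ∀ m → ¬ ι R (suc m) ≈ 0#
  ι-suc≉0 m ι≈0 = <-irrefl refl (proj₁ <-resp-≈ ι≈0 (0<ι-suc m))

  ι-pos≉0 : ∀ {m} → 0 ℕ.< m → ¬ ι R m ≈ 0#
  ι-pos≉0 {suc m} _ = ι-suc≉0 m

  x*y≈0⇒y≈0 : ∀ {x y} → ¬ x ≈ 0# → x * y ≈ 0# → y ≈ 0#
  x*y≈0⇒y≈0 {x} {y} x≉0 xy≈0 with inverse x x≉0
  ... | x⁻¹ , xx⁻¹≈1 = begin
    y                ≈⟨ solve 3 (λ x y z → y := y :* con 1) refl x y x⁻¹ ⟩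
    y * 1#           ≈⟨ *-congˡ (sym xx⁻¹≈1) ⟩
    y * (x * x⁻¹)    ≈⟨ solve 3 (λ x y z → y :* (x :* z) := (x :* y) :* z) refl x y x⁻¹ ⟩
    (x * y) * x⁻¹    ≈⟨ *-congʳ xy≈0 ⟩
    0# * x⁻¹         ≈⟨ zeroˡ x⁻¹ ⟩
    0#               ∎

  *-≉0 : ∀ {x y} → ¬ x ≈ 0# → ¬ y ≈ 0# → ¬ x * y ≈ 0#
  *-≉0 x≉0 y≉0 xy≈0 = y≉0 (x*y≈0⇒y≈0 x≉0 xy≈0)

  0*0-0≈0 : 0# * 0# - 0# ≈ 0#
  0*0-0≈0 = trans (+-congʳ (zeroˡ _)) (-‿inverseʳ _)

  1*1-1≈0 : 1# * 1# - 1# ≈ 0#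
  1*1-1≈0 = trans (+-congʳ (*-identityˡ _)) (-‿inverseʳ _)

  0+0-1≉0 : ¬ 0# + 0# - 1# ≈ 0#
  0+0-1≉0 -1≈0 = 0≉1 (sym (begin
    1#         ≈⟨ sym (-‿involutive 1#) ⟩
    - - 1#     ≈⟨ -‿cong (trans (sym (+-identityˡ _)) (trans (+-congʳ (sym (+-identityˡ 0#))) -1≈0)) ⟩
    - 0#       ≈⟨ -0#≈0# ⟩
    0#         ∎))

  1+1-1≉0 : ¬ 1# + 1# - 1# ≈ 0#
  1+1-1≉0 1≈0 = 0≉1 (sym (trans (sym 1+1-1≈1) 1≈0))
    where
    1+1-1≈1 : 1# + 1# - 1# ≈ 1#
    1+1-1≈1 = trans (+-assoc _ _ _) (trans (+-congˡ (-‿inverseʳ _)) (+-identityʳ _))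

  y≈0⇒x*y≈0 : ∀ x {y} → y ≈ 0# → x * y ≈ 0#
  y≈0⇒x*y≈0 x y≈0 = trans (*-congˡ y≈0) (zeroʳ x)

  x≈0⇒x*y≈0 : ∀ {x} y → x ≈ 0# → x * y ≈ 0#
  x≈0⇒x*y≈0 y x≈0 = trans (*-congʳ x≈0) (zeroˡ y)

  0+0+0≈0 : 0# + 0# + 0# ≈ 0#
  0+0+0≈0 = trans (+-identityʳ _) (+-identityʳ 0#)

  x-y+y≈x : ∀ x y → x - y + y ≈ x
  x-y+y≈x x y = trans (+-assoc _ _ _) (trans (+-congˡ (-‿inverseˡ y)) (+-identityʳ x))

  x≈z+y⇒x-y≈z : ∀ {x y z} → x ≈ z + y → x - y ≈ z
  x≈z+y⇒x-y≈z {x} {y} {z} x≈z+y = begin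
    x - y        ≈⟨ +-congʳ x≈z+y ⟩
    z + y - y    ≈⟨ +-assoc _ _ _ ⟩
    z + (y - y)  ≈⟨ +-congˡ (-‿inverseʳ y) ⟩
    z + 0#       ≈⟨ +-identityʳ z ⟩
    z            ∎

  linExt : ∀ {n} → (Monomial n → Carrier) → Poly R n → Carrier
  linExt F []            = 0#
  linExt F ((c , e) ∷ P) = c * F e + linExt F P

  linExt-++ : ∀ {n} F (P Q : Poly R n) → linExt F (P ++ Q) ≈ linExt F P + linExt F Q
  linExt-++ F []            Q = sym (+-identityˡ _)
  linExt-++ F ((c , e) ∷ P) Q = trans (+-congˡ (linExt-++ F P Q)) (sym (+-assoc _ _ _))

  linExt-neg : ∀ {n} F (P : Poly R n) → linExt F (_-ₚ_ R [] P) ≈ - linExt F P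
  linExt-neg F []            = sym -0#≈0#
  linExt-neg F ((c , e) ∷ P) = trans (+-cong (sym (-‿distribˡ-* c (F e))) (linExt-neg F P)) (-‿+-comm _ _)

  linExt-sub : ∀ {n} F (Q P : Poly R n) → linExt F (_-ₚ_ R Q P) ≈ linExt F Q - linExt F P
  linExt-sub F Q P = trans (linExt-++ F Q _) (+-congˡ (linExt-neg F P))

  linExt-cong : ∀ {n} {F G : Monomial n → Carrier} → (∀ e → F e ≈ G e) → ∀ P → linExt F P ≈ linExt G P
  linExt-cong F≈G []            = refl
  linExt-cong F≈G ((c , e) ∷ P) = +-cong (*-congˡ (F≈G e)) (linExt-cong F≈G P)

  linExt-+ : ∀ {n} F G (P : Poly R n) → linExt (λ e → F e + G e) P ≈ linExt F P + linExt G P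
  linExt-+ F G []            = sym (+-identityʳ 0#)
  linExt-+ F G ((c , e) ∷ P) = trans (+-congˡ (linExt-+ F G P))
    (solve 5 (λ c f g s t → c :* (f :+ g) :+ (s :+ t) := (c :* f :+ s) :+ (c :* g :+ t)) refl c (F e) (G e) _ _)

  linExt-*ˡ : ∀ {n} x F (P : Poly R n) → linExt (λ e → x * F e) P ≈ x * linExt F P
  linExt-*ˡ x F []            = sym (zeroʳ x)
  linExt-*ˡ x F ((c , e) ∷ P) = trans (+-congˡ (linExt-*ˡ x F P))
    (solve 4 (λ x c f s → c :* (x :* f) :+ x :* s := x :* (c :* f :+ s)) refl x c (F e) _)

  coef-++ : ∀ {n} (P Q : Poly R n) m → coef R (P ++ Q) m ≈ coef R P m + coef R Q m
  coef-++ []            Q m = sym (+-identityˡ _)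
  coef-++ ((c , e) ∷ P) Q m with ≡-dec ℕ._≟_ e m
  ... | yes _ = trans (+-congˡ (coef-++ P Q m)) (sym (+-assoc _ _ _))
  ... | no  _ = coef-++ P Q m

  coef-neg : ∀ {n} (P : Poly R n) m → coef R (_-ₚ_ R [] P) m ≈ - coef R P m
  coef-neg []            m = sym -0#≈0#
  coef-neg ((c , e) ∷ P) m with ≡-dec ℕ._≟_ e m
  ... | yes _ = trans (+-congˡ (coef-neg P m)) (-‿+-comm _ _)
  ... | no  _ = coef-neg P m

  coef-sub : ∀ {n} (Q P : Poly R n) m → coef R (_-ₚ_ R Q P) m ≈ coef R Q m - coef R P m
  coef-sub Q P m = trans (coef-++ Q _ m) (+-congˡ (coef-neg P m))

  module _ {n} {Q : Monomial n → Set} (Q? : ∀ e → Dec (Q e)) where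

    keep : Poly R n → Poly R n
    keep = filter (Q? ∘ proj₂)

    coef-keep-∈ : ∀ P {m} → Q m → coef R (keep P) m ≡ coef R P m
    coef-keep-∈ []            Qm = ≡.refl
    coef-keep-∈ ((c , e) ∷ P) {m} Qm with Q? e
    ... | yes _ with ≡-dec ℕ._≟_ e m
    ...   | yes _ = ≡.cong (c +_) (coef-keep-∈ P Qm)
    ...   | no  _ = coef-keep-∈ P Qm
    coef-keep-∈ ((c , e) ∷ P) {m} Qm | no ¬Qe with ≡-dec ℕ._≟_ e m
    ...   | yes ≡.refl = ⊥-elim (¬Qe Qm)
    ...   | no  _      = coef-keep-∈ P Qm

    coef-keep-∉ : ∀ P {m} → ¬ Q m → coef R (keep P) m ≡ 0#
    coef-keep-∉ []            ¬Qm = ≡.refl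
    coef-keep-∉ ((c , e) ∷ P) {m} ¬Qm with Q? e
    ... | no  _ = coef-keep-∉ P ¬Qm
    ... | yes Qe with ≡-dec ℕ._≟_ e m
    ...   | yes ≡.refl = ⊥-elim (¬Qm Qe)
    ...   | no  _      = coef-keep-∉ P ¬Qm

  coef-here : ∀ {n} c (e : Monomial n) P → coef R ((c , e) ∷ P) e ≈ c + coef R P e
  coef-here c e P with ≡-dec ℕ._≟_ e e
  ... | yes _   = refl
  ... | no  e≢e = ⊥-elim (e≢e ≡.refl)

  coef-there : ∀ {n} c (e : Monomial n) P {m} → e ≢ m → coef R ((c , e) ∷ P) m ≈ coef R P m
  coef-there c e P {m} e≢m with ≡-dec ℕ._≟_ e m
  ... | yes e≡m = ⊥-elim (e≢m e≡m)
  ... | no  _   = refl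

  without : ∀ {n} → Monomial n → Poly R n → Poly R n
  without m = keep (λ e → ¬? (≡-dec ℕ._≟_ e m))

  linExt-split : ∀ {n} F (m : Monomial n) P → linExt F P ≈ coef R P m * F m + linExt F (without m P)
  linExt-split F m []            = sym (trans (+-identityʳ _) (zeroˡ _))
  linExt-split F m ((c , e) ∷ P) with ≡-dec ℕ._≟_ e m
  ... | yes ≡.refl = trans (+-congˡ (linExt-split F m P))
    (solve 4 (λ c f k s → c :* f :+ (k :* f :+ s) := (c :+ k) :* f :+ s) refl c (F e) (coef R P e) _)
  ... | no  _      = trans (+-congˡ (linExt-split F m P))
    (solve 5 (λ c f k g s → c :* f :+ (k :* g :+ s) := k :* g :+ (c :* f :+ s)) refl c (F e) (coef R P m) (F m) _)

  linExt-coef≈0 : ∀ {n} F (P : Poly R n) → (∀ m → coef R P m ≈ 0#) → linExt F P ≈ 0#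
  linExt-coef≈0 F P = go (length P) P ℕₚ.≤-refl
    where
    go : ∀ N P → length P ≤ N → (∀ m → coef R P m ≈ 0#) → linExt F P ≈ 0#
    go _       []            _            _      = refl
    go (suc N) ((c , e) ∷ P) (s≤s |P|≤N) coef≈0 = begin
      c * F e + linExt F P                                  ≈⟨ +-congˡ (linExt-split F e P) ⟩
      c * F e + (coef R P e * F e + linExt F (without e P))
        ≈⟨ solve 4 (λ c k f s → c :* f :+ (k :* f :+ s) := (c :+ k) :* f :+ s) refl c (coef R P e) (F e) _ ⟩
      (c + coef R P e) * F e + linExt F (without e P)
        ≈⟨ +-cong (x≈0⇒x*y≈0 (F e) (trans (sym (coef-here c e P)) (coef≈0 e)))
                  (go N (without e P) (ℕₚ.≤-trans (Listₚ.length-filter _ P) |P|≤N) rest≈0) ⟩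
      0# + 0#                                               ≈⟨ +-identityʳ 0# ⟩
      0#                                                    ∎
      where
      rest≈0 : ∀ m → coef R (without e P) m ≈ 0#
      rest≈0 m with ≡-dec ℕ._≟_ m e
      ... | yes m≡e = reflexive (coef-keep-∉ _ P (λ m≢e → m≢e m≡e))
      ... | no  m≢e = trans (reflexive (coef-keep-∈ _ P m≢e))
                            (trans (sym (coef-there c e P (m≢e ∘ ≡.sym))) (coef≈0 m))

  linExt-≈ₚ : ∀ {n} F (P P′ : Poly R n) → _≈ₚ_ R P P′ → linExt F P ≈ linExt F P′
  linExt-≈ₚ F P P′ P≈P′ = x∙y⁻¹≈ε⇒x≈y _ _ (trans (sym (linExt-sub F P P′))
    (linExt-coef≈0 F (_-ₚ_ R P P′) λ m → trans (coef-sub P P′ m) (x≈y⇒x∙y⁻¹≈ε (P≈P′ m))))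

  -- Derivatives

  -- dpow j a τ is the a-th derivative of t^j at τ, so that deriv P α p is (∂^α P)(p).
  dpow : ℕ → ℕ → Carrier → Carrier
  dpow j a τ = ι R (ff j a) * pow R τ (j ℕ.∸ a)

  dmon : ∀ {n} → Monomial n → Vec ℕ n → Vec Carrier n → Carrier
  dmon []      []      []      = 1#
  dmon (j ∷ e) (a ∷ α) (τ ∷ p) = dpow j a τ * dmon e α p

  deriv : ∀ {n} → Poly R n → Vec ℕ n → Vec Carrier n → Carrier
  deriv P α p = linExt (λ e → dmon e α p) P

  dpow-zero : ∀ j τ → dpow j 0 τ ≈ pow R τ j
  dpow-zero j τ = trans (*-congʳ (+-identityʳ 1#)) (*-identityˡ _)

  dpow-∂ : ∀ j a τ → ι R j * dpow (pred j) a τ ≈ dpow j (suc a) τ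
  dpow-∂ zero    a τ = trans (zeroˡ _) (sym (zeroˡ _))
  dpow-∂ (suc j) a τ = trans (sym (*-assoc _ _ _)) (*-congʳ (sym (ι-* (suc j) (ff j a))))

  dmon-∂ : ∀ {n} (i : Fin n) e α p →
    ι R (lookup e i) * dmon (updateAt e i pred) α p ≈ dmon e (updateAt α i suc) p
  dmon-∂ zero    (j ∷ e) (a ∷ α) (τ ∷ p) = trans (sym (*-assoc _ _ _)) (*-congʳ (dpow-∂ j a τ))
  dmon-∂ (suc i) (j ∷ e) (a ∷ α) (τ ∷ p) = trans (x∙yz≈y∙xz _ _ _) (*-congˡ (dmon-∂ i e α p))

  deriv-∂ : ∀ {n} (i : Fin n) P α p → deriv (∂ R i P) α p ≈ deriv P (updateAt α i suc) p
  deriv-∂ i []            α p = refl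
  deriv-∂ i ((c , e) ∷ P) α p = +-cong (trans (*-assoc _ _ _) (*-congˡ (dmon-∂ i e α p))) (deriv-∂ i P α p)

  deriv-∂* : ∀ {n} is (P : Poly R n) α p → deriv (∂* R is P) α p ≈ deriv P (tally is α) p
  deriv-∂* []       P α p = refl
  deriv-∂* (i ∷ is) P α p = trans (deriv-∂ i (∂* R is P) α p) (deriv-∂* is P (updateAt α i suc) p)

  eval≈deriv : ∀ {n} (P : Poly R n) p → eval R P p ≈ deriv P (replicate n 0) p
  eval≈deriv []            p = refl
  eval≈deriv ((c , e) ∷ P) p = +-cong (*-congˡ (evalMon≈dmon e p)) (eval≈deriv P p)
    where
    evalMon≈dmon : ∀ {n} (e : Monomial n) p → evalMon R e p ≈ dmon e (replicate n 0) p
    evalMon≈dmon []      []      = refl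
    evalMon≈dmon (j ∷ e) (τ ∷ p) = *-cong (sym (dpow-zero j τ)) (evalMon≈dmon e p)

  VanishesTo : ∀ {n} → Poly R n → Vec Carrier n → ℕ → Set
  VanishesTo P p m = ∀ α → mdeg α ℕ.< m → deriv P α p ≈ 0#

  zeroOfMult⇒vanishesTo : ∀ {n} {P : Poly R n} {p m} → ZeroOfMult R P p m → VanishesTo P p m
  zeroOfMult⇒vanishesTo {n} {P} {p} {m} vanish α |α|<m = begin
    deriv P α p                                     ≈⟨ reflexive (≡.cong (λ β → deriv P β p) (≡.sym (tally-indices α))) ⟩
    deriv P (tally (indices α) (replicate n 0)) p   ≈⟨ sym (deriv-∂* (indices α) P _ p) ⟩
    deriv (∂* R (indices α) P) (replicate n 0) p    ≈⟨ sym (eval≈deriv (∂* R (indices α) P) p) ⟩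
    eval R (∂* R (indices α) P) p                   ≈⟨ vanish (indices α) (≡.subst (ℕ._< m) (≡.sym (length-indices α)) |α|<m) ⟩
    0#                                              ∎

  vanishesTo-mono : ∀ {n} {P : Poly R n} {p m m′} → m ≤ m′ → VanishesTo P p m′ → VanishesTo P p m
  vanishesTo-mono m≤m′ vanish α |α|<m = vanish α (ℕₚ.<-≤-trans |α|<m m≤m′)

  vanishesTo-sub : ∀ {n} {Q P₁ P₂ : Poly R n} {p m} → ZeroOfMult R (_-ₚ_ R Q P₁) p m → ZeroOfMult R (_-ₚ_ R Q P₂) p m →
    VanishesTo (_-ₚ_ R P₁ P₂) p m
  vanishesTo-sub {Q = Q} {P₁} {P₂} {p} vanish₁ vanish₂ α |α|<m = begin
    deriv (_-ₚ_ R P₁ P₂) α p    ≈⟨ linExt-sub _ P₁ P₂ ⟩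
    deriv P₁ α p - deriv P₂ α p ≈⟨ x≈y⇒x∙y⁻¹≈ε (trans (sym (agrees vanish₁)) (agrees vanish₂)) ⟩
    0#                          ∎
    where
    agrees : ∀ {P} → ZeroOfMult R (_-ₚ_ R Q P) p _ → deriv Q α p ≈ deriv P α p
    agrees vanish = x∙y⁻¹≈ε⇒x≈y _ _ (trans (sym (linExt-sub _ Q _)) (zeroOfMult⇒vanishesTo vanish α |α|<m))

  Null : ∀ {n} → Poly R n → Set
  Null P = ∀ α p → deriv P α p ≈ 0#

  pow-0# : ∀ {m} → 0 ℕ.< m → pow R 0# m ≈ 0#
  pow-0# {suc m} _ = zeroˡ _

  dpow-origin-≢ : ∀ {j a} → j ≢ a → dpow j a 0# ≈ 0#
  dpow-origin-≢ {j} {a} j≢a with ℕₚ.<-cmp j a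
  ... | tri< j<a _ _ = trans (*-congʳ (reflexive (≡.cong (ι R) (ff-< j<a)))) (zeroˡ _)
  ... | tri≈ _ j≡a _ = ⊥-elim (j≢a j≡a)
  ... | tri> _ _ a<j = trans (*-congˡ (pow-0# (ℕₚ.m<n⇒0<n∸m a<j))) (zeroʳ _)

  dpow-origin-≉0 : ∀ a → ¬ dpow a a 0# ≈ 0#
  dpow-origin-≉0 a = *-≉0 (ι-pos≉0 (ff-diag>0 a)) λ pow≈0 →
    0≉1 (sym (trans (reflexive (≡.cong (pow R 0#) (≡.sym (ℕₚ.n∸n≡0 a)))) pow≈0))

  dmon-origin-≢ : ∀ {n} {e α : Monomial n} → e ≢ α → dmon e α (replicate n 0#) ≈ 0#
  dmon-origin-≢ {e = []}    {[]}    []≢[] = ⊥-elim ([]≢[] ≡.refl)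
  dmon-origin-≢ {e = j ∷ e} {a ∷ α} e≢α with j ℕ.≟ a
  ... | yes ≡.refl = trans (*-congˡ (dmon-origin-≢ (e≢α ∘ ≡.cong (j ∷_)))) (zeroʳ _)
  ... | no  j≢a    = trans (*-congʳ (dpow-origin-≢ j≢a)) (zeroˡ _)

  dmon-origin-≉0 : ∀ {n} (α : Monomial n) → ¬ dmon α α (replicate n 0#) ≈ 0#
  dmon-origin-≉0 []      = 0≉1 ∘ sym
  dmon-origin-≉0 (a ∷ α) = *-≉0 (dpow-origin-≉0 a) (dmon-origin-≉0 α)

  deriv-origin : ∀ {n} (P : Poly R n) α → deriv P α (replicate n 0#) ≈ dmon α α (replicate n 0#) * coef R P α
  deriv-origin []            α = sym (zeroʳ _)
  deriv-origin ((c , e) ∷ P) α with ≡-dec ℕ._≟_ e α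
  ... | yes ≡.refl = trans (+-congˡ (deriv-origin P e))
    (solve 3 (λ c w k → c :* w :+ w :* k := w :* (c :+ k)) refl c _ _)
  ... | no  e≢α    = trans (+-cong (trans (*-congˡ (dmon-origin-≢ e≢α)) (zeroʳ _)) (deriv-origin P α)) (+-identityˡ _)

  null⇒coef≈0 : ∀ {n} (P : Poly R n) → Null P → ∀ m → coef R P m ≈ 0#
  null⇒coef≈0 P null m = x*y≈0⇒y≈0 (dmon-origin-≉0 m) (trans (sym (deriv-origin P m)) (null m _))

  dpow-suc : ∀ j a τ → dpow (suc j) a τ ≈ τ * dpow j a τ + ι R a * dpow j (pred a) τ
  dpow-suc j zero    τ = begin
    ι R 1 * (τ * pow R τ j)                           ≈⟨ x∙yz≈y∙xz _ _ _ ⟩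
    τ * dpow j 0 τ                                    ≈⟨ sym (+-identityʳ _) ⟩
    τ * dpow j 0 τ + 0#                               ≈⟨ +-congˡ (sym (zeroˡ _)) ⟩
    τ * dpow j 0 τ + 0# * dpow j 0 τ                  ∎
  dpow-suc j (suc a) τ = begin
    ι R (suc j ℕ.* ff j a) * pw                       ≈⟨ *-congʳ (reflexive (≡.cong (ι R) (ff-pascal j a))) ⟩
    ι R (ff j (suc a) ℕ.+ suc a ℕ.* ff j a) * pw      ≈⟨ *-congʳ (trans (ι-+ (ff j (suc a)) _) (+-congˡ (ι-* (suc a) (ff j a)))) ⟩
    (ι R (ff j (suc a)) + ι R (suc a) * ι R (ff j a)) * pw
      ≈⟨ solve 4 (λ x y z p → (x :+ y :* z) :* p := x :* p :+ y :* (z :* p)) refl _ _ _ pw ⟩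
    ι R (ff j (suc a)) * pw + ι R (suc a) * dpow j a τ ≈⟨ +-congʳ lower ⟩
    τ * dpow j (suc a) τ + ι R (suc a) * dpow j a τ   ∎
    where
    pw = pow R τ (j ℕ.∸ a)
    lower : ι R (ff j (suc a)) * pw ≈ τ * dpow j (suc a) τ
    lower with j ℕ.≤? a
    ... | yes j≤a = begin
      ι R (ff j (suc a)) * pw                         ≈⟨ *-congʳ (reflexive (≡.cong (ι R) ff≡0)) ⟩
      0# * pw                                         ≈⟨ zeroˡ _ ⟩
      0#                                              ≈⟨ sym (trans (*-congˡ (trans (*-congʳ (reflexive (≡.cong (ι R) ff≡0))) (zeroˡ _))) (zeroʳ τ)) ⟩
      τ * dpow j (suc a) τ                            ∎
      where ff≡0 = ff-< (s≤s j≤a)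
    ... | no  j≰a = trans (*-congˡ (reflexive (≡.cong (pow R τ) (∸-suc (ℕₚ.≰⇒> j≰a))))) (x∙yz≈y∙xz _ _ _)

  t²-t-expansion : ∀ τ X Y Z A A′ →
    (τ * (τ * X + A * Y) + A * (τ * Y + A′ * Z)) - (τ * X + A * Y)
      ≈ (τ * τ - τ) * X + (A * (τ + τ - 1#)) * Y + (A * A′) * Z
  t²-t-expansion τ X Y Z A A′ = x≈z+y⇒x-y≈z (begin
    τ * (τ * X + A * Y) + A * (τ * Y + A′ * Z)
      ≈⟨ solve 6 (λ τ X Y Z A A′ → τ :* (τ :* X :+ A :* Y) :+ A :* (τ :* Y :+ A′ :* Z)
                                 := (τ :* τ) :* X :+ A :* (τ :+ τ) :* Y :+ (A :* A′) :* Z) refl τ X Y Z A A′ ⟩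
    (τ * τ) * X + A * (τ + τ) * Y + (A * A′) * Z
      ≈⟨ +-congʳ (+-cong (*-congʳ (sym (x-y+y≈x _ τ))) (*-congʳ (*-congˡ (sym (x-y+y≈x _ 1#))))) ⟩
    (σ + τ) * X + A * (ρ + 1#) * Y + (A * A′) * Z
      ≈⟨ solve 7 (λ σ ρ τ X Y A B → (σ :+ τ) :* X :+ A :* (ρ :+ con 1) :* Y :+ B
                                  := σ :* X :+ (A :* ρ) :* Y :+ B :+ (τ :* X :+ A :* Y)) refl σ ρ τ X Y A ((A * A′) * Z) ⟩
    σ * X + (A * ρ) * Y + (A * A′) * Z + (τ * X + A * Y) ∎)
    where
    σ = τ * τ - τ
    ρ = τ + τ - 1#

  dpow-t²-t : ∀ i a τ → dpow (suc (suc i)) a τ - dpow (suc i) a τ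
    ≈ (τ * τ - τ) * dpow i a τ + (ι R a * (τ + τ - 1#)) * dpow i (pred a) τ
      + (ι R a * ι R (pred a)) * dpow i (pred (pred a)) τ
  dpow-t²-t i a τ = trans
    (+-cong (trans (dpow-suc (suc i) a τ) (+-cong (*-congˡ (dpow-suc i a τ)) (*-congˡ (dpow-suc i (pred a) τ))))
            (-‿cong (dpow-suc i a τ)))
    (t²-t-expansion τ _ _ _ (ι R a) (ι R (pred a)))

  -- Splitting off the first variable

  constPart : ∀ {n} → Poly R (suc n) → Poly R n
  constPart []                    = []
  constPart ((c , zero  ∷ e) ∷ P) = (c , e) ∷ constPart P
  constPart ((c , suc j ∷ e) ∷ P) = constPart P

  linPart : ∀ {n} → Poly R (suc n) → Poly R n
  linPart []                    = []
  linPart ((c , zero  ∷ e) ∷ P) = linPart P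
  linPart ((c , suc j ∷ e) ∷ P) = (c , e) ∷ linPart P

  -- c t^j x^e = c t x^e + (t² − t) c (t^{j−2} + ⋯ + t + 1) x^e  for j ≥ 1
  quotTerms : ∀ {n} → Carrier → ℕ → Monomial n → Poly R (suc n)
  quotTerms c (suc (suc i)) e = (c , i ∷ e) ∷ quotTerms c (suc i) e
  quotTerms c _             e = []

  quotPart : ∀ {n} → Poly R (suc n) → Poly R (suc n)
  quotPart []                = []
  quotPart ((c , j ∷ e) ∷ P) = quotTerms c j e ++ quotPart P

  mul-t²-t : ∀ {n} → Poly R (suc n) → Poly R (suc n)
  mul-t²-t []                = []
  mul-t²-t ((c , i ∷ e) ∷ C) = (c , suc (suc i) ∷ e) ∷ (- c , suc i ∷ e) ∷ mul-t²-t C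

  -- F precomposed with multiplication by t² − t
  Δ : ∀ {n} → (Monomial (suc n) → Carrier) → Monomial (suc n) → Carrier
  Δ F (i ∷ e) = F (suc (suc i) ∷ e) - F (suc i ∷ e)

  linExt-mul-t²-t : ∀ {n} F (C : Poly R (suc n)) → linExt F (mul-t²-t C) ≈ linExt (Δ F) C
  linExt-mul-t²-t F []                = refl
  linExt-mul-t²-t F ((c , i ∷ e) ∷ C) =
    trans (sym (+-assoc _ _ _)) (+-cong (sym c*[x-y]≈cx+[-c]y) (linExt-mul-t²-t F C))
    where
    c*[x-y]≈cx+[-c]y : ∀ {x y} → c * (x - y) ≈ c * x + (- c) * y
    c*[x-y]≈cx+[-c]y {x} {y} = trans (x[y-z]≈xy-xz c x y) (+-congˡ (-‿distribˡ-* c y))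

  linExt-quotTerms : ∀ {n} F c j (e : Monomial n) →
    linExt (Δ F) (quotTerms c (suc j) e) + c * F (1 ∷ e) ≈ c * F (suc j ∷ e)
  linExt-quotTerms F c zero    e = +-identityˡ _
  linExt-quotTerms F c (suc i) e = begin
    c * (F₂ - F₁) + linExt (Δ F) (quotTerms c (suc i) e) + c * F (1 ∷ e)
      ≈⟨ trans (+-assoc _ _ _) (+-congˡ (linExt-quotTerms F c i e)) ⟩
    c * (F₂ - F₁) + c * F₁   ≈⟨ sym (distribˡ c _ _) ⟩
    c * (F₂ - F₁ + F₁)       ≈⟨ *-congˡ (x-y+y≈x F₂ F₁) ⟩
    c * F₂                   ∎
    where
    F₂ = F (suc (suc i) ∷ e)
    F₁ = F (suc i ∷ e)

  linExt-decompose : ∀ {n} F (P : Poly R (suc n)) → linExt F P ≈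
    linExt (F ∘ (0 ∷_)) (constPart P) + linExt (F ∘ (1 ∷_)) (linPart P) + linExt (Δ F) (quotPart P)
  linExt-decompose F []                    = sym (trans (+-identityʳ _) (+-identityʳ 0#))
  linExt-decompose F ((c , zero ∷ e) ∷ P)  = trans (+-congˡ (linExt-decompose F P))
    (solve 4 (λ x a b q → x :+ (a :+ b :+ q) := x :+ a :+ b :+ q) refl _ _ _ _)
  linExt-decompose F ((c , suc j ∷ e) ∷ P) = begin
    c * F (suc j ∷ e) + linExt F P
      ≈⟨ +-cong (sym (linExt-quotTerms F c j e)) (linExt-decompose F P) ⟩
    (T + c * F (1 ∷ e)) + (A + B + Q)
      ≈⟨ solve 5 (λ t x a b q → (t :+ x) :+ (a :+ b :+ q) := a :+ (x :+ b) :+ (t :+ q)) refl T _ A B Q ⟩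
    A + (c * F (1 ∷ e) + B) + (T + Q)
      ≈⟨ +-congˡ (sym (linExt-++ (Δ F) (quotTerms c (suc j) e) (quotPart P))) ⟩
    A + (c * F (1 ∷ e) + B) + linExt (Δ F) (quotTerms c (suc j) e ++ quotPart P) ∎
    where
    T = linExt (Δ F) (quotTerms c (suc j) e)
    A = linExt (F ∘ (0 ∷_)) (constPart P)
    B = linExt (F ∘ (1 ∷_)) (linPart P)
    Q = linExt (Δ F) (quotPart P)

  deriv-decompose : ∀ {n} (P : Poly R (suc n)) a α τ p → deriv P (a ∷ α) (τ ∷ p) ≈
    dpow 0 a τ * deriv (constPart P) α p + dpow 1 a τ * deriv (linPart P) α p
      + deriv (mul-t²-t (quotPart P)) (a ∷ α) (τ ∷ p)
  deriv-decompose P a α τ p = trans (linExt-decompose _ P)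
    (+-cong (+-cong (linExt-*ˡ _ _ (constPart P)) (linExt-*ˡ _ _ (linPart P))) (sym (linExt-mul-t²-t _ (quotPart P))))

  deriv-mul-t²-t : ∀ {n} (C : Poly R (suc n)) a α τ p → deriv (mul-t²-t C) (a ∷ α) (τ ∷ p) ≈
    (τ * τ - τ) * deriv C (a ∷ α) (τ ∷ p) + (ι R a * (τ + τ - 1#)) * deriv C (pred a ∷ α) (τ ∷ p)
      + (ι R a * ι R (pred a)) * deriv C (pred (pred a) ∷ α) (τ ∷ p)
  deriv-mul-t²-t C a α τ p = trans (linExt-mul-t²-t _ C) (trans (linExt-cong leibniz C)
    (trans (linExt-+ _ _ C) (+-cong (trans (linExt-+ _ _ C) (+-cong (linExt-*ˡ σ _ C) (linExt-*ˡ ρ _ C))) (linExt-*ˡ κ _ C))))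
    where
    σ = τ * τ - τ
    ρ = ι R a * (τ + τ - 1#)
    κ = ι R a * ι R (pred a)
    leibniz : ∀ e → Δ (λ e → dmon e (a ∷ α) (τ ∷ p)) e ≈ σ * dmon e (a ∷ α) (τ ∷ p)
      + ρ * dmon e (pred a ∷ α) (τ ∷ p) + κ * dmon e (pred (pred a) ∷ α) (τ ∷ p)
    leibniz (i ∷ e) = begin
      dpow (suc (suc i)) a τ * w - dpow (suc i) a τ * w  ≈⟨ sym ([y-z]x≈yx-zx w _ _) ⟩
      (dpow (suc (suc i)) a τ - dpow (suc i) a τ) * w    ≈⟨ *-congʳ (dpow-t²-t i a τ) ⟩
      (σ * X + ρ * Y + κ * Z) * w
        ≈⟨ solve 7 (λ s r k x y z w → (s :* x :+ r :* y :+ k :* z) :* w := s :* (x :* w) :+ r :* (y :* w) :+ k :* (z :* w))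
                   refl σ ρ κ X Y Z w ⟩
      σ * (X * w) + ρ * (Y * w) + κ * (Z * w)            ∎
      where
      w = dmon e α p
      X = dpow i a τ
      Y = dpow i (pred a) τ
      Z = dpow i (pred (pred a)) τ

  null-mul-t²-t : ∀ {n} (C : Poly R (suc n)) → Null C → Null (mul-t²-t C)
  null-mul-t²-t C null (a ∷ α) (τ ∷ p) = trans (deriv-mul-t²-t C a α τ p)
    (trans (+-cong (+-cong (y≈0⇒x*y≈0 _ (null _ _)) (y≈0⇒x*y≈0 _ (null _ _))) (y≈0⇒x*y≈0 _ (null _ _))) 0+0+0≈0)

  deriv≈deriv-quot : ∀ {n} (P : Poly R (suc n)) → Null (constPart P) → Null (linPart P) →
    ∀ α p → deriv P α p ≈ deriv (mul-t²-t (quotPart P)) α p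
  deriv≈deriv-quot P nullA nullB (a ∷ α) (τ ∷ p) = trans (deriv-decompose P a α τ p)
    (trans (+-congʳ (trans (+-cong (y≈0⇒x*y≈0 _ (nullA α p)) (y≈0⇒x*y≈0 _ (nullB α p))) (+-identityʳ 0#))) (+-identityˡ _))

  null-decompose : ∀ {n} (P : Poly R (suc n)) → Null (constPart P) → Null (linPart P) → Null (quotPart P) → Null P
  null-decompose P nullA nullB nullC α p = trans (deriv≈deriv-quot P nullA nullB α p) (null-mul-t²-t (quotPart P) nullC α p)

  vanishesTo-mul-quotPart : ∀ {n} (P : Poly R (suc n)) {p m} → Null (constPart P) → Null (linPart P) →
    VanishesTo P p m → VanishesTo (mul-t²-t (quotPart P)) p m
  vanishesTo-mul-quotPart P nullA nullB vanish α |α|<m = trans (sym (deriv≈deriv-quot P nullA nullB α _)) (vanish α |α|<m)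

  deriv-slice : ∀ {n} (P : Poly R (suc n)) {τ} → τ * τ - τ ≈ 0# →
    ∀ α p → deriv P (0 ∷ α) (τ ∷ p) ≈ deriv (constPart P) α p + τ * deriv (linPart P) α p
  deriv-slice P {τ} idem α p = trans (deriv-decompose P 0 α τ p) (trans
    (+-cong (+-cong (trans (*-congʳ (dpow-zero 0 τ)) (*-identityˡ _)) (*-congʳ (trans (dpow-zero 1 τ) (*-identityʳ τ))))
            quot≈0)
    (+-identityʳ _))
    where
    quot≈0 : deriv (mul-t²-t (quotPart P)) (0 ∷ α) (τ ∷ p) ≈ 0#
    quot≈0 = trans (deriv-mul-t²-t (quotPart P) 0 α τ p)
      (trans (+-cong (+-cong (x≈0⇒x*y≈0 _ idem) (x≈0⇒x*y≈0 _ (zeroˡ _))) (x≈0⇒x*y≈0 _ (zeroˡ _))) 0+0+0≈0)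

  vanishesTo-constPart : ∀ {n} (P : Poly R (suc n)) {p m} → VanishesTo P (0# ∷ p) m → VanishesTo (constPart P) p m
  vanishesTo-constPart P {p} vanish α |α|<m = begin
    deriv (constPart P) α p                                  ≈⟨ sym (+-identityʳ _) ⟩
    deriv (constPart P) α p + 0#                             ≈⟨ +-congˡ (sym (zeroˡ _)) ⟩
    deriv (constPart P) α p + 0# * deriv (linPart P) α p     ≈⟨ sym (deriv-slice P 0*0-0≈0 α p) ⟩
    deriv P (0 ∷ α) (0# ∷ p)                                 ≈⟨ vanish (0 ∷ α) |α|<m ⟩
    0#                                                       ∎

  slice-1# : ∀ {n} (P : Poly R (suc n)) α p → deriv P (0 ∷ α) (1# ∷ p) ≈ deriv (constPart P) α p + deriv (linPart P) α p
  slice-1# P α p = trans (deriv-slice P 1*1-1≈0 α p) (+-congˡ (*-identityˡ _))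

  vanishesTo-linPart : ∀ {n} (P : Poly R (suc n)) {p m} → VanishesTo P (0# ∷ p) m → VanishesTo P (1# ∷ p) m →
    VanishesTo (linPart P) p m
  vanishesTo-linPart P {p} vanish₀ vanish₁ α |α|<m = begin
    deriv (linPart P) α p                                ≈⟨ sym (+-identityˡ _) ⟩
    0# + deriv (linPart P) α p                           ≈⟨ +-congʳ (sym (vanishesTo-constPart P vanish₀ α |α|<m)) ⟩
    deriv (constPart P) α p + deriv (linPart P) α p      ≈⟨ sym (slice-1# P α p) ⟩
    deriv P (0 ∷ α) (1# ∷ p)                             ≈⟨ vanish₁ (0 ∷ α) |α|<m ⟩
    0#                                                   ∎

  vanishesTo-constPart-at-1# : ∀ {n} (P : Poly R (suc n)) {p m} → Null (linPart P) → VanishesTo P (1# ∷ p) m →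
    VanishesTo (constPart P) p m
  vanishesTo-constPart-at-1# P {p} nullB vanish₁ α |α|<m = begin
    deriv (constPart P) α p                              ≈⟨ sym (+-identityʳ _) ⟩
    deriv (constPart P) α p + 0#                         ≈⟨ +-congˡ (sym (nullB α p)) ⟩
    deriv (constPart P) α p + deriv (linPart P) α p      ≈⟨ sym (slice-1# P α p) ⟩
    deriv P (0 ∷ α) (1# ∷ p)                             ≈⟨ vanish₁ (0 ∷ α) |α|<m ⟩
    0#                                                   ∎

  vanishesTo-quotient : ∀ {n} {τ} → τ * τ - τ ≈ 0# → ¬ τ + τ - 1# ≈ 0# → ∀ (C : Poly R (suc n)) {p m} →
    VanishesTo (mul-t²-t C) (τ ∷ p) (suc m) → VanishesTo C (τ ∷ p) m
  vanishesTo-quotient {τ = τ} idem 2τ-1≉0 C {p} {m} vanish (a ∷ α) = go a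
    where
    D : ℕ → Carrier
    D a = deriv C (a ∷ α) (τ ∷ p)
    go : ∀ a → a ℕ.+ mdeg α ℕ.< m → D a ≈ 0#
    go a a+|α|<m = x*y≈0⇒y≈0 (*-≉0 (ι-suc≉0 a) 2τ-1≉0) (begin
      ρ * D a                                              ≈⟨ sym (trans (+-congʳ (+-identityˡ _)) (+-identityʳ _)) ⟩
      0# + ρ * D a + 0#                                    ≈⟨ sym (+-cong (+-congʳ (x≈0⇒x*y≈0 _ idem)) (below a a+|α|<m)) ⟩
      (τ * τ - τ) * D (suc a) + ρ * D a + κ * D (pred a)    ≈⟨ sym (deriv-mul-t²-t C (suc a) α τ p) ⟩
      deriv (mul-t²-t C) (suc a ∷ α) (τ ∷ p)               ≈⟨ vanish (suc a ∷ α) (s≤s a+|α|<m) ⟩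
      0#                                                   ∎)
      where
      ρ = ι R (suc a) * (τ + τ - 1#)
      κ = ι R (suc a) * ι R a
      below : ∀ a → a ℕ.+ mdeg α ℕ.< m → (ι R (suc a) * ι R a) * D (pred a) ≈ 0#
      below zero    _           = x≈0⇒x*y≈0 _ (zeroʳ _)
      below (suc b) 1+b+|α|<m = y≈0⇒x*y≈0 _ (go b (ℕₚ.<-trans (ℕₚ.n<1+n _) 1+b+|α|<m))

  vanishesTo-quotient-cube : ∀ {n} (C : Poly R (suc n)) (b : Vec Bool (suc n)) m →
    VanishesTo (mul-t²-t C) (pt R b) m → VanishesTo C (pt R b) (m ℕ.∸ 1)
  vanishesTo-quotient-cube C b           zero    _ α ()
  vanishesTo-quotient-cube C (true  ∷ b) (suc m) = vanishesTo-quotient 1*1-1≈0 1+1-1≉0 C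
  vanishesTo-quotient-cube C (false ∷ b) (suc m) = vanishesTo-quotient 0*0-0≈0 0+0-1≉0 C

  -- The vanishing lemmas

  AllMonomials : ∀ {n} → (Monomial n → Set) → Poly R n → Set
  AllMonomials Q = All (Q ∘ proj₂)

  module _ {n} {Q : Monomial (suc n) → Set} where

    allMonomials-constPart : ∀ {Q′ : Monomial n → Set} → (∀ {e} → Q (0 ∷ e) → Q′ e) →
      ∀ P → AllMonomials Q P → AllMonomials Q′ (constPart P)
    allMonomials-constPart f []                    []       = []
    allMonomials-constPart f ((c , zero  ∷ e) ∷ P) (q ∷ qs) = f q ∷ allMonomials-constPart f P qs
    allMonomials-constPart f ((c , suc j ∷ e) ∷ P) (q ∷ qs) = allMonomials-constPart f P qs

    allMonomials-linPart : ∀ {Q′ : Monomial n → Set} → (∀ {j e} → Q (suc j ∷ e) → Q′ e) →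
      ∀ P → AllMonomials Q P → AllMonomials Q′ (linPart P)
    allMonomials-linPart f []                    []       = []
    allMonomials-linPart f ((c , zero  ∷ e) ∷ P) (q ∷ qs) = allMonomials-linPart f P qs
    allMonomials-linPart f ((c , suc j ∷ e) ∷ P) (q ∷ qs) = f q ∷ allMonomials-linPart f P qs

    allMonomials-quotPart : ∀ {Q′ : Monomial (suc n) → Set} →
      (∀ {i j e} → suc (suc i) ≤ j → Q (j ∷ e) → Q′ (i ∷ e)) →
      ∀ P → AllMonomials Q P → AllMonomials Q′ (quotPart P)
    allMonomials-quotPart {Q′} f []                []       = []
    allMonomials-quotPart {Q′} f ((c , j ∷ e) ∷ P) (q ∷ qs) =
      Allₚ.++⁺ (terms j (λ i i+2≤j → f i+2≤j q)) (allMonomials-quotPart f P qs)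
      where
      terms : ∀ j → (∀ i → suc (suc i) ≤ j → Q′ (i ∷ e)) → AllMonomials Q′ (quotTerms c j e)
      terms zero          _ = []
      terms (suc zero)    _ = []
      terms (suc (suc i)) h = h i ℕₚ.≤-refl ∷ terms (suc i) (λ i′ i′+2≤1+i → h i′ (ℕₚ.m≤n⇒m≤1+n i′+2≤1+i))

  allMonomials-none : ∀ {n} {Q : Monomial n → Set} → (∀ e → ¬ Q e) → ∀ {P} → AllMonomials Q P → Null P
  allMonomials-none ¬Q []      α p = refl
  allMonomials-none ¬Q (q ∷ _)     = ⊥-elim (¬Q _ q)

  noSquares-vanishing⇒null : ∀ n k (P : Poly R n) → AllMonomials (NoSquares k) P →
    (∀ b → VanishesTo P (pt R b) k) → Null P
  noSquares-vanishing⇒null n       zero    P noSq _      = allMonomials-none (λ e noSqₑ → noSqₑ (divBySquares-zero e)) noSq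
  noSquares-vanishing⇒null zero    (suc k) P _    vanish [] [] = vanish [] [] (s≤s z≤n)
  noSquares-vanishing⇒null (suc n) (suc k) P noSq vanish = null-decompose P nullA nullB nullC
    where
    nullA : Null (constPart P)
    nullA = noSquares-vanishing⇒null n (suc k) (constPart P)
      (allMonomials-constPart noSquares-tail P noSq)
      (λ b → vanishesTo-constPart P (vanish (false ∷ b)))
    nullB : Null (linPart P)
    nullB = noSquares-vanishing⇒null n (suc k) (linPart P)
      (allMonomials-linPart noSquares-tail P noSq)
      (λ b → vanishesTo-linPart P (vanish (false ∷ b)) (vanish (true ∷ b)))
    nullC : Null (quotPart P)
    nullC = noSquares-vanishing⇒null (suc n) k (quotPart P)
      (allMonomials-quotPart noSquares-quot P noSq)
      (λ b → vanishesTo-quotient-cube (quotPart P) b (suc k) (vanishesTo-mul-quotPart P nullA nullB (vanish b)))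

  reduced-vanishing⇒null : ∀ n k (P : Poly R n) → AllMonomials (ReducedMonomial k) P →
    (∀ b → b ≢ replicate n false → VanishesTo P (pt R b) k) →
    VanishesTo P (pt R (replicate n false)) (k ℕ.∸ 1) → Null P
  reduced-vanishing⇒null n       zero          P red _ _ =
    allMonomials-none (λ e (noSq , _) → noSq (divBySquares-zero e)) red
  reduced-vanishing⇒null zero    (suc zero)    P red _ _ =
    allMonomials-none (λ e (_ , deg) → 3≰2 (ℕₚ.≤-trans (ℕₚ.m≤n+m 3 (mdeg e)) deg)) red
    where
    3≰2 : ¬ 3 ≤ 2
    3≰2 (s≤s (s≤s ()))
  reduced-vanishing⇒null zero    (suc (suc k)) P _   _ vanish₀ [] [] = vanish₀ [] (s≤s z≤n)
  reduced-vanishing⇒null (suc n) (suc k)       P red vanish vanish₀ = null-decompose P nullA nullB nullC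
    where
    0ₙ = replicate n false
    vanishAt : ∀ β b → b ≢ 0ₙ → VanishesTo P (pt R (β ∷ b)) (suc k)
    vanishAt β b b≢0 = vanish (β ∷ b) (b≢0 ∘ ∷-injectiveʳ)
    nullB : Null (linPart P)
    nullB = reduced-vanishing⇒null n (suc k) (linPart P)
      (allMonomials-linPart reducedMonomial-tail P red)
      (λ b b≢0 → vanishesTo-linPart P (vanishAt false b b≢0) (vanishAt true b b≢0))
      (vanishesTo-linPart P vanish₀ (vanishesTo-mono {P = P} (ℕₚ.n≤1+n k) (vanish (true ∷ 0ₙ) λ ())))
    nullA : Null (constPart P)
    nullA = noSquares-vanishing⇒null n (suc k) (constPart P)
      (allMonomials-constPart (noSquares-tail ∘ proj₁) P red)
      (λ b → vanishesTo-constPart-at-1# P nullB (vanish (true ∷ b) λ ()))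
    nullC : Null (quotPart P)
    nullC = reduced-vanishing⇒null (suc n) k (quotPart P)
      (allMonomials-quotPart reducedMonomial-quot P red)
      (λ b b≢0 → vanishesTo-quotient-cube (quotPart P) b (suc k) (vanishesTo-mul-quotPart P nullA nullB (vanish b b≢0)))
      (vanishesTo-quotient-cube (quotPart P) (false ∷ 0ₙ) k (vanishesTo-mul-quotPart P nullA nullB vanish₀))

  -- Reduced only constrains monomials with nonzero total coefficient; support drops the others.
  support : ∀ {n} → Poly R n → Poly R n
  support P = keep (λ e → ¬? (coef R P e ≈? 0#)) P

  support-≈ₚ : ∀ {n} (P : Poly R n) → _≈ₚ_ R (support P) P
  support-≈ₚ P m with coef R P m ≈? 0#
  ... | yes c≈0 = trans (reflexive (coef-keep-∉ _ P (λ c≉0 → c≉0 c≈0))) (sym c≈0)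
  ... | no  c≉0 = reflexive (coef-keep-∈ _ P c≉0)

  reduced-sub : ∀ {n} k (P₁ P₂ : Poly R n) → Reduced R k P₁ → Reduced R k P₂ → Reduced R k (_-ₚ_ R P₁ P₂)
  reduced-sub k P₁ P₂ red₁ red₂ e c≉0 with coef R P₁ e ≈? 0# | coef R P₂ e ≈? 0#
  ... | no  c₁≉0 | _        = red₁ e c₁≉0
  ... | yes _    | no c₂≉0  = red₂ e c₂≉0
  ... | yes c₁≈0 | yes c₂≈0 = ⊥-elim (c≉0 (begin
    coef R (_-ₚ_ R P₁ P₂) e      ≈⟨ coef-sub P₁ P₂ e ⟩
    coef R P₁ e - coef R P₂ e    ≈⟨ x≈y⇒x∙y⁻¹≈ε (trans c₁≈0 (sym c₂≈0)) ⟩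
    0#                           ∎))

  reduced-vanishing⇒coef≈0 : ∀ {n k} → 1 ≤ n → 2 ≤ k → (P : Poly R n) → Reduced R k P →
    (∀ b → b ≢ replicate n false → VanishesTo P (pt R b) k) →
    VanishesTo P (pt R (replicate n false)) (k ℕ.∸ 1) → ∀ m → coef R P m ≈ 0#
  reduced-vanishing⇒coef≈0 {n} {k} 1≤n 2≤k P red vanish vanish₀ m =
    trans (sym (support-≈ₚ P m)) (null⇒coef≈0 (support P) nullSupport m)
    where
    3≤n+2k : 3 ≤ n ℕ.+ 2 ℕ.* k
    3≤n+2k = ℕₚ.+-mono-≤ 1≤n (ℕₚ.≤-trans 2≤k (ℕₚ.m≤m+n k (k ℕ.+ 0)))
    reducedMonomials : AllMonomials (ReducedMonomial k) (support P)
    reducedMonomials = All.map (λ {(_ , e)} c≉0 → let (deg , noSq) = red e c≉0 in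
                                  noSq , ℕₚ.m≤o∸n⇒m+n≤o (mdeg e) 3≤n+2k deg)
                               (Allₚ.all-filter _ P)
    onSupport : ∀ {p j} → VanishesTo P p j → VanishesTo (support P) p j
    onSupport vanishP α |α|<j = trans (linExt-≈ₚ _ (support P) P (support-≈ₚ P)) (vanishP α |α|<j)
    nullSupport : Null (support P)
    nullSupport = reduced-vanishing⇒null n k (support P) reducedMonomials
      (λ b b≢0 → onSupport (vanish b b≢0)) (onSupport vanish₀)

  coef-sub≈0⇒≈ₚ : ∀ {n} (P₁ P₂ : Poly R n) → (∀ m → coef R (_-ₚ_ R P₁ P₂) m ≈ 0#) → _≈ₚ_ R P₁ P₂
  coef-sub≈0⇒≈ₚ P₁ P₂ sub≈0 m = x∙y⁻¹≈ε⇒x≈y _ _ (trans (sym (coef-sub P₁ P₂ m)) (sub≈0 m))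

corollary2p4 : (R : RealField) (k n : ℕ) → 2 ≤ k → 1 ≤ n →
    (Q P₁ P₂ : Poly R n) →
    Reduced R k P₁ → Interpolates R k Q P₁ →
    Reduced R k P₂ → Interpolates R k Q P₂ →
    _≈ₚ_ R P₁ P₂
corollary2p4 R k n 2≤k 1≤n Q P₁ P₂ red₁ (cube₁ , origin₁) red₂ (cube₂ , origin₂) =
  coef-sub≈0⇒≈ₚ R P₁ P₂ (reduced-vanishing⇒coef≈0 R 1≤n 2≤k (_-ₚ_ R P₁ P₂)
    (reduced-sub R k P₁ P₂ red₁ red₂)
    (λ b b≢0 → vanishesTo-sub R {Q = Q} (cube₁ b b≢0) (cube₂ b b≢0))
    (vanishesTo-sub R {Q = Q} origin₁ origin₂))
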